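{- Let $M=\langle Q,C,\delta,q_I,F\rangle$ be a reduced multicounter automaton. Let $\Sigma$ consist of unary predicates $q$ (for each $q\in Q$), $inc_c, dec_c$ (for each $c\in C$), $\min,\max$, and binary predicates $<,{+1},s$. Let $\varphi_M$ be the conjunction of: (1) $\exists^{=1}x.\min(x)\wedge\exists^{=1}x.\max(x)$; (2) $\forall x\forall y.(\min(x)\to(x<y\vee x=y))\wedge(\max(x)\to(y<x\vee y=x))$; (3) $\forall x.(\bigvee_{q\in Q}q(x))\wedge\bigwedge_{q\in Q}(q(x)\to\bigwedge_{q'\in Q\setminus\{q\}}\neg q'(x))$; (4) $\forall x.(\min(x)\to q_I(x))\wedge(\max(x)\to\bigvee_{q_F\in F}q_F(x))$; (5) $\forall x\forall y.{+1}(x,y)\to\big(\bigvee_{\langle q,inc(c),q'\rangle\in\delta}(q(x)\wedge inc_c(x)\wedge q'(y))\vee\bigvee_{\langle q,dec(c),q'\rangle\in\delta}(q(x)\wedge dec_c(x)\wedge q'(y))\big)$; (6) $\forall x.\neg\max(x)\to\bigvee_{c\in C}(inc_c(x)\vee dec_c(x))$; (7) $\forall x.\bigwedge_{c\in C}\big(inc_c(x)\to\neg dec_c(x)\wedge\bigwedge_{c'\in C\setminus\{c\}}(\neg dec_{c'}(x)\wedge\neg inc_{c'}(x))\big)$; (8) $\forall x.\bigwedge_{c\in C}\big(dec_c(x)\to\neg inc_c(x)\wedge\bigwedge_{c'\in C\setminus\{c\}}(\neg inc_{c'}(x)\wedge\neg dec_{c'}(x))\big)$; (9) $\forall x.\max(x)\to\bigwedge_{c\in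 C}(\neg inc_c(x)\wedge\neg dec_c(x))$; (10) $\forall x\forall y.s(x,y)\to\bigvee_{c\in C}(inc_c(x)\wedge dec_c(y))$; (11) $\forall x\forall y.s(x,y)\to x<y$; (12) $\forall x.(\max(x)\vee\exists^{=1}y.(s(x,y)\vee s(y,x)))$. Then $\varphi_M$, interpreted as a $\mathrm{C}^2(*,1,\{<,{+1}\})$ sentence (with $<$ a strict linear order and ${+1}$ its induced successor relation), has a finite model if and only if $M$ has an accepting run.
   Context: A multicounter automaton (MCA) is a tuple $\langle Q,C,R,\delta,q_I,F\rangle$ with finite state set $Q$, initial state $q_I$, final states $F\subseteq Q$, finite set of counters $C$, $R\subseteq C$, and transition relation $\delta\subseteq Q\times\{inc(c),dec(c),skip: c\in C\}\times Q$. It is reduced if it has no skip transitions and $R=C$ (then $R$ is omitted). A configuration is $\langle p,\vec n\rangle$ with $p\in Q$, $\vec n\in\mathbb{N}^C$. Transition $\langle p,inc(c),q\rangle$ maps $\langle p,\vec n\rangle$ to $\langle q,\vec n'\rangle$ where $\vec n'$ increments component $c$; $\langle p,dec(c),q\rangle$ applies only if $\vec n(c)>0$ and decrements component $c$; skip leaves counters unchanged. A run is a sequence of configurations and transitions in which each transition applied to the preceding configuration yields the next. It is accepting if it starts in $\langle q_I,\vec 0\rangle$ and ends in some $\langle q_F,\vec n_F\rangle$ with $q_F\in F$ and $\vec n_F(c)=0$ for all $c\in R$. $\mathrm{C}^2$ is the two-variable fragment of first-order logic with counting quantifiers $\exists^{=k}$ etc. -}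

module Defs where

open import Data.Nat using (ℕ; zero; suc; _∸_; _<_)
open import Data.Fin using (Fin; _≟_)
open import Data.Bool using (Bool; T; if_then_else_)
open import Data.Product using (Σ; ∃; ∃-syntax; _×_; _,_)
open import Data.Sum using (_⊎_)
open import Relation.Nullary using (¬_; does)
open import Relation.Binary.PropositionalEquality using (_≡_; _≢_)

data Op (nC : ℕ) : Set where
  inc : Fin nC → Op nC
  dec : Fin nC → Op nC

-- A reduced MCA ⟨Q, C, δ, q_I, F⟩ (no skip transitions, R = C).
-- δ and F are given as (decidable) subsets.
record MCA (nQ nC : ℕ) : Set where
  field
    δ  : Fin nQ → Op nC → Fin nQ → Bool
    qI : Fin nQ
    F  : Fin nQ → Bool

Config : ℕ → ℕ → Set
Config nQ nC = Fin nQ × (Fin nC → ℕ)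

incV : ∀ {nC} → Fin nC → (Fin nC → ℕ) → (Fin nC → ℕ)
incV c v d = if does (d ≟ c) then suc (v d) else v d

decV : ∀ {nC} → Fin nC → (Fin nC → ℕ) → (Fin nC → ℕ)
decV c v d = if does (d ≟ c) then v d ∸ 1 else v d

module _ {nQ nC : ℕ} (M : MCA nQ nC) where
  open MCA M

  data Step : Config nQ nC → Config nQ nC → Set where
    stepInc : ∀ {p q c v} → T (δ p (inc c) q) → Step (p , v) (q , incV c v)
    stepDec : ∀ {p q c v} → T (δ p (dec c) q) → 0 < v c → Step (p , v) (q , decV c v)

  data Run : Config nQ nC → Config nQ nC → Set where
    done : ∀ {κ} → Run κ κ
    step : ∀ {κ κ' κ''} → Step κ κ' → Run κ' κ'' → Run κ κ''

  HasAcceptingRun : Set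
  HasAcceptingRun = Σ (Fin nQ) λ qF → Σ (Fin nC → ℕ) λ v →
    T (F qF) × (∀ c → v c ≡ 0) × Run (qI , (λ _ → 0)) (qF , v)

record Structure (nQ nC : ℕ) : Set where
  field
    n    : ℕ
    st   : Fin nQ → Fin n → Bool
    incP : Fin nC → Fin n → Bool
    decP : Fin nC → Fin n → Bool
    minP : Fin n → Bool
    maxP : Fin n → Bool
    lt   : Fin n → Fin n → Bool
    sc   : Fin n → Fin n → Bool
    s    : Fin n → Fin n → Bool

ExactlyOne : ∀ {n} → (Fin n → Set) → Set
ExactlyOne {n} P = Σ (Fin n) λ x → P x × (∀ y → P y → y ≡ x)

OrderedStructure : ∀ {nQ nC} → Structure nQ nC → Set
OrderedStructure 𝔄 =
    (∀ x → ¬ T (lt x x))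
  × (∀ x y z → T (lt x y) → T (lt y z) → T (lt x z))
  × (∀ x y → x ≢ y → T (lt x y) ⊎ T (lt y x))
  × (∀ x y → (T (sc x y) → T (lt x y) × (∀ z → ¬ (T (lt x z) × T (lt z y))))
           × (T (lt x y) × (∀ z → ¬ (T (lt x z) × T (lt z y))) → T (sc x y)))
  where open Structure 𝔄

Satisfies : ∀ {nQ nC} → MCA nQ nC → Structure nQ nC → Set
Satisfies {nQ} {nC} M 𝔄 =
    (ExactlyOne (λ x → T (minP x)) × ExactlyOne (λ x → T (maxP x)))
  × (∀ x y → (T (minP x) → T (lt x y) ⊎ x ≡ y) × (T (maxP x) → T (lt y x) ⊎ y ≡ x))
  × (∀ x → (∃[ q ] T (st q x))
         × (∀ q → T (st q x) → ∀ q' → q' ≢ q → ¬ T (st q' x)))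
  × (∀ x → (T (minP x) → T (st qI x))
         × (T (maxP x) → ∃[ qF ] (T (F qF) × T (st qF x))))
  × (∀ x y → T (sc x y) →
        (Σ (Fin nQ) λ q → Σ (Fin nC) λ c → Σ (Fin nQ) λ q' →
           T (δ q (inc c) q') × T (st q x) × T (incP c x) × T (st q' y))
      ⊎ (Σ (Fin nQ) λ q → Σ (Fin nC) λ c → Σ (Fin nQ) λ q' →
           T (δ q (dec c) q') × T (st q x) × T (decP c x) × T (st q' y)))
  × (∀ x → ¬ T (maxP x) → ∃[ c ] (T (incP c x) ⊎ T (decP c x)))
  × (∀ x c → T (incP c x) → ¬ T (decP c x)
        × (∀ c' → c' ≢ c → ¬ T (decP c' x) × ¬ T (incP c' x)))
  × (∀ x c → T (decP c x) → ¬ T (incP c x)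
        × (∀ c' → c' ≢ c → ¬ T (incP c' x) × ¬ T (decP c' x)))
  × (∀ x → T (maxP x) → ∀ c → ¬ T (incP c x) × ¬ T (decP c x))
  × (∀ x y → T (s x y) → ∃[ c ] (T (incP c x) × T (decP c y)))
  × (∀ x y → T (s x y) → T (lt x y))
  × (∀ x → T (maxP x) ⊎ ExactlyOne (λ y → T (s x y) ⊎ T (s y x)))
  where
    open MCA M
    open Structure 𝔄

HasFiniteModel : ∀ {nQ nC} → MCA nQ nC → Set
HasFiniteModel {nQ} {nC} M =
  Σ (Structure nQ nC) λ 𝔄 → OrderedStructure 𝔄 × Satisfies M 𝔄

-- A model of φ_M is a run written out position by position: the positions form a <-chain, each
-- carries the current state and the operation performed next, and s pairs every increment of a
-- counter with a later decrement of the same counter. Reading the value of counter c at position y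
-- as the number of increments of c before y whose s-partner is not before y, every +1-step changes
-- it exactly as the operation labelling that step does; the minimum has no earlier increments and at
-- the maximum every increment is already matched, so walking from min to max is an accepting run.
-- Conversely, the trace of an accepting run on positions 0, …, k, with the t-th increment of each
-- counter matched to its t-th decrement, is a model: the counter value is the number of increments
-- minus decrements so far, so a decrement finds its match earlier because the counter is positive
-- there, and every increment finds a later match because the counters end at zero.

module Submission where

open import Defs
open import Level using (Level)
open import Data.Bool using (T)
open import Data.Fin using (Fin; zero; suc; _≟_; toℕ; fromℕ; fromℕ<)
open import Data.Fin.Properties using (any?; suc-injective; toℕ<n; toℕ-fromℕ<; toℕ-fromℕ; toℕ-injective)
open import Data.Maybe using (Maybe; just; nothing)
open import Data.Maybe.Properties using (≡-dec; just-injective)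
open import Data.Nat using (ℕ; zero; suc; _+_; _∸_; _≤_; _<_; z≤n; s≤s; z<s)
import Data.Nat as ℕ
open import Data.Nat.Induction using (<-wellFounded)
open import Data.Nat.Properties
  using (≤-refl; ≤-reflexive; ≤-trans; ≤-antisym; <-irrefl; <-trans; <-≤-trans; <-cmp; _<?_;
         n≤1+n; n<1+n; m≤n⇒m≤1+n; m<n⇒m<1+n; m≤n⇒m<n∨m≡n; m<1+n⇒m<n∨m≡n; m<1+n⇒m≤n;
         <⇒≢; ≮⇒≥; <⇒≱; m<n+m; m+[n∸m]≡n; +-suc)
open import Data.Product using (Σ; ∃-syntax; _×_; _,_; _,′_; proj₁; proj₂; map₁; map₂)
open import Data.Sum using (_⊎_; inj₁; inj₂; [_,_])
open import Data.Unit using (tt)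
open import Function using (id; _∘_; case_of_; flip; _⇔_; mk⇔; Equivalence)
open import Function.Construct.Symmetry using (⇔-sym)
open import Induction.WellFounded using (WellFounded; Acc; acc)
import Induction.WellFounded as WF
import Relation.Binary.Construct.On as On
open import Relation.Binary using (Rel; Transitive; DecidableEquality; tri<; tri≈; tri>)
open import Relation.Binary.PropositionalEquality
  using (_≡_; _≢_; _≗_; refl; sym; trans; cong; cong₂; subst; module ≡-Reasoning)
open import Relation.Nullary using (¬_; Dec; yes; no; contradiction; map′)
open import Relation.Nullary.Decidable using (T?; ¬?; ⌊_⌋; toWitness; fromWitness; _×-dec_; _⊎-dec_)
open import Relation.Unary using (Pred; Decidable; _⊆_; Empty)

open ≡-Reasoning

private
  variable
    p ℓ : Level
    m : ℕ

count : {P : Pred (Fin m) p} → Decidable P → ℕ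
count {zero}  _  = 0
count {suc m} P? with P? zero
... | yes _ = suc (count (P? ∘ suc))
... | no  _ = count (P? ∘ suc)

count-mono : {P Q : Pred (Fin m) p} (P? : Decidable P) (Q? : Decidable Q) →
             P ⊆ Q → count P? ≤ count Q?
count-mono {zero}  _  _  _ = z≤n
count-mono {suc m} P? Q? P⊆Q with P? zero | Q? zero
... | yes _  | yes _  = s≤s (count-mono (P? ∘ suc) (Q? ∘ suc) P⊆Q)
... | yes P0 | no ¬Q0 = contradiction (P⊆Q P0) ¬Q0
... | no _   | yes _  = m≤n⇒m≤1+n (count-mono (P? ∘ suc) (Q? ∘ suc) P⊆Q)
... | no _   | no _   = count-mono (P? ∘ suc) (Q? ∘ suc) P⊆Q

count-cong : {P Q : Pred (Fin m) p} (P? : Decidable P) (Q? : Decidable Q) →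
             (∀ {a} → P a ⇔ Q a) → count P? ≡ count Q?
count-cong P? Q? P⇔Q =
  ≤-antisym (count-mono P? Q? (Equivalence.to P⇔Q)) (count-mono Q? P? (Equivalence.from P⇔Q))

count-empty : {P : Pred (Fin m) p} (P? : Decidable P) → Empty P → count P? ≡ 0
count-empty {zero}  _  _ = refl
count-empty {suc m} P? ∅ with P? zero
... | yes P0 = contradiction P0 (∅ zero)
... | no  _  = count-empty (P? ∘ suc) (∅ ∘ suc)

count-insert : {P Q : Pred (Fin m) p} (P? : Decidable P) (Q? : Decidable Q) {e : Fin m} →
               ¬ P e → Q e → (∀ {a} → a ≢ e → P a ⇔ Q a) → count Q? ≡ suc (count P?)
count-insert {suc m} P? Q? {zero} ¬Pe Qe P⇔Q with P? zero | Q? zero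
... | yes Pe | _      = contradiction Pe ¬Pe
... | no _   | no ¬Qe = contradiction Qe ¬Qe
... | no _   | yes _  = cong suc (sym (count-cong (P? ∘ suc) (Q? ∘ suc) (P⇔Q (λ ()))))
count-insert {suc m} P? Q? {suc e} ¬Pe Qe P⇔Q with P? zero | Q? zero
... | yes _  | yes _   = cong suc (count-insert (P? ∘ suc) (Q? ∘ suc) ¬Pe Qe (λ a≢e → P⇔Q (a≢e ∘ suc-injective)))
... | no _   | no _    = count-insert (P? ∘ suc) (Q? ∘ suc) ¬Pe Qe (λ a≢e → P⇔Q (a≢e ∘ suc-injective))
... | yes P0 | no ¬Q0  = contradiction (Equivalence.to (P⇔Q (λ ())) P0) ¬Q0
... | no ¬P0 | yes Q0  = contradiction (Equivalence.from (P⇔Q (λ ())) Q0) ¬P0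

count-strict : {P Q : Pred (Fin m) p} (P? : Decidable P) (Q? : Decidable Q) {e : Fin m} →
               P ⊆ Q → ¬ P e → Q e → count P? < count Q?
count-strict {P = P} P? Q? {e} P⊆Q ¬Pe Qe =
  subst (_≤ count Q?) (count-insert P? P+e? ¬Pe (inj₂ refl) P⇔P+e)
                      (count-mono P+e? Q? [ P⊆Q , (λ { refl → Qe }) ])
  where
  P+e? : Decidable (λ a → P a ⊎ a ≡ e)
  P+e? a = P? a ⊎-dec a ≟ e
  P⇔P+e : ∀ {a} → a ≢ e → P a ⇔ (P a ⊎ a ≡ e)
  P⇔P+e a≢e = mk⇔ inj₁ [ id , (λ a≡e → contradiction a≡e a≢e) ]

countBelow : {P : Pred ℕ p} → Decidable P → ℕ → ℕ
countBelow P? zero = 0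
countBelow P? (suc i) with P? i
... | yes _ = suc (countBelow P? i)
... | no  _ = countBelow P? i

module _ {P : Pred ℕ p} (P? : Decidable P) where

  countBelow-yes : ∀ {i} → P i → countBelow P? (suc i) ≡ suc (countBelow P? i)
  countBelow-yes {i} Pi with P? i
  ... | yes _  = refl
  ... | no ¬Pi = contradiction Pi ¬Pi

  countBelow-no : ∀ {i} → ¬ P i → countBelow P? (suc i) ≡ countBelow P? i
  countBelow-no {i} ¬Pi with P? i
  ... | yes Pi = contradiction Pi ¬Pi
  ... | no _   = refl

  countBelow-suc : ∀ i → countBelow P? i ≤ countBelow P? (suc i)
  countBelow-suc i with P? i
  ... | yes _ = n≤1+n _
  ... | no  _ = ≤-refl

  countBelow-mono : ∀ {i j} → i ≤ j → countBelow P? i ≤ countBelow P? j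
  countBelow-mono {i} {zero}  z≤n = ≤-refl
  countBelow-mono {i} {suc j} i≤1+j with m≤n⇒m<n∨m≡n i≤1+j
  ... | inj₂ refl = ≤-refl
  ... | inj₁ i<1+j = ≤-trans (countBelow-mono (m<1+n⇒m≤n i<1+j)) (countBelow-suc j)

  countBelow-strict : ∀ {i j} → P i → i < j → countBelow P? i < countBelow P? j
  countBelow-strict {i} Pi i<j =
    subst (_≤ _) (countBelow-yes Pi) (countBelow-mono {suc i} i<j)

  countBelow-injective : ∀ {i j} → P i → P j → countBelow P? i ≡ countBelow P? j → i ≡ j
  countBelow-injective {i} {j} Pi Pj eq with <-cmp i j
  ... | tri< i<j _ _ = contradiction eq (<⇒≢ (countBelow-strict Pi i<j))
  ... | tri≈ _ i≡j _ = i≡j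
  ... | tri> _ _ j<i = contradiction (sym eq) (<⇒≢ (countBelow-strict Pj j<i))

  -- Prefix counts grow in unit steps, so every smaller value is attained at a point of P.
  countBelow-attains : ∀ {t j} → t < countBelow P? j → ∃[ i ] (i < j × P i × countBelow P? i ≡ t)
  countBelow-attains {t} {suc j} t<count with P? j
  ... | no _ = map₂ (map₁ m<n⇒m<1+n) (countBelow-attains t<count)
  ... | yes Pj with m<1+n⇒m<n∨m≡n t<count
  ...   | inj₂ refl     = j , n<1+n j , Pj , refl
  ...   | inj₁ t<count′ = map₂ (map₁ m<n⇒m<1+n) (countBelow-attains t<count′)

module FifoMatching {I D : Pred ℕ p} (I? : Decidable I) (D? : Decidable D) where

  Matched : ℕ → ℕ → Set p
  Matched i j = I i × D j × countBelow I? i ≡ countBelow D? j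

  matched? : ∀ i j → Dec (Matched i j)
  matched? i j = I? i ×-dec D? j ×-dec countBelow I? i ℕ.≟ countBelow D? j

  matched-functional : ∀ {i j j'} → Matched i j → Matched i j' → j ≡ j'
  matched-functional (_ , Dj , eq) (_ , Dj' , eq') = countBelow-injective D? Dj Dj' (trans (sym eq) eq')

  matched-injective : ∀ {i i' j} → Matched i j → Matched i' j → i ≡ i'
  matched-injective (Ii , _ , eq) (Ii' , _ , eq') = countBelow-injective I? Ii Ii' (trans eq (sym eq'))

  module _ {j} (fewer-D : countBelow D? j < countBelow I? j) where

    matched-< : ∀ {i} → Matched i j → i < j
    matched-< {i} (_ , _ , eq) with i <? j
    ... | yes i<j = i<j
    ... | no  i≮j = contradiction (countBelow-mono I? (≮⇒≥ i≮j))
                                  (<⇒≱ (subst (_< countBelow I? j) (sym eq) fewer-D))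

    matched-from : D j → ∃[ i ] Matched i j
    matched-from Dj with countBelow-attains I? {j = j} fewer-D
    ... | i , _ , Ii , eq = i , Ii , Dj , eq

  matched-to : ∀ {i k} → I i → i < k → countBelow I? k ≤ countBelow D? k →
               ∃[ j ] (j < k × Matched i j)
  matched-to Ii i<k balanced with countBelow-attains D? (<-≤-trans (countBelow-strict I? Ii i<k) balanced)
  ... | j , j<k , Dj , eq = j , j<k , Ii , Dj , sym eq

module FiniteStrictOrder {_≺_ : Rel (Fin m) ℓ} (_≺?_ : ∀ x y → Dec (x ≺ y))
                         (≺-irrefl : ∀ x → ¬ x ≺ x) (≺-trans : Transitive _≺_) where

  ≺-wellFounded : WellFounded _≺_
  ≺-wellFounded = WF.Subrelation.wellFounded fewer-below (On.wellFounded below <-wellFounded)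
    where
    below : Fin m → ℕ
    below y = count (_≺? y)
    fewer-below : ∀ {x y} → x ≺ y → below x < below y
    fewer-below {x} {y} x≺y =
      count-strict (_≺? x) (_≺? y) (λ a≺x → ≺-trans a≺x x≺y) (≺-irrefl x) x≺y

  ≻-wellFounded : WellFounded (flip _≺_)
  ≻-wellFounded = WF.Subrelation.wellFounded fewer-above (On.wellFounded above <-wellFounded)
    where
    above : Fin m → ℕ
    above x = count (x ≺?_)
    fewer-above : ∀ {x y} → y ≺ x → above x < above y
    fewer-above {x} {y} y≺x = count-strict (x ≺?_) (y ≺?_) (≺-trans y≺x) (≺-irrefl x) y≺x

  Covers : Fin m → Fin m → Set ℓ
  Covers x z = x ≺ z × (∀ w → ¬ (x ≺ w × w ≺ z))

  cover-exists : ∀ {x y} → x ≺ y → ∃[ z ] Covers x z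
  cover-exists {x} {y} = go y (≺-wellFounded y)
    where
    go : ∀ y → Acc _≺_ y → x ≺ y → ∃[ z ] Covers x z
    go y (acc rs) x≺y with any? (λ w → x ≺? w ×-dec w ≺? y)
    ... | no ∄w = y , x≺y , λ w x≺w≺y → ∄w (w , x≺w≺y)
    ... | yes (w , x≺w , w≺y) = go w (rs w≺y) x≺w

suc-toℕ⇔covers : {x y : Fin m} →
                 suc (toℕ x) ≡ toℕ y ⇔ (toℕ x < toℕ y × ∀ z → ¬ (toℕ x < toℕ z × toℕ z < toℕ y))
suc-toℕ⇔covers {m} {x} {y} = mk⇔ to from
  where
  to : suc (toℕ x) ≡ toℕ y → toℕ x < toℕ y × ∀ z → ¬ (toℕ x < toℕ z × toℕ z < toℕ y)
  to 1+x≡y = ≤-reflexive 1+x≡y , λ z (x<z , z<y) → <⇒≱ z<y (subst (_≤ toℕ z) 1+x≡y x<z)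
  from : toℕ x < toℕ y × (∀ z → ¬ (toℕ x < toℕ z × toℕ z < toℕ y)) → suc (toℕ x) ≡ toℕ y
  from (x<y , nothing-between) with m≤n⇒m<n∨m≡n x<y
  ... | inj₂ 1+x≡y = 1+x≡y
  ... | inj₁ 1+x<y = contradiction (≤-reflexive (sym toℕ-z) , subst (_< toℕ y) (sym toℕ-z) 1+x<y)
                                   (nothing-between z)
    where
    z : Fin m
    z = fromℕ< (<-trans 1+x<y (toℕ<n y))
    toℕ-z : toℕ z ≡ suc (toℕ x)
    toℕ-z = toℕ-fromℕ< (<-trans 1+x<y (toℕ<n y))

module ModelToRun {nQ nC : ℕ} (M : MCA nQ nC) (𝔄 : Structure nQ nC) where
  open MCA M
  open Structure 𝔄

  infix 4 _≺_ _⋖_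
  _≺_ _⋖_ : Fin n → Fin n → Set
  x ≺ y = T (lt x y)
  x ⋖ y = T (sc x y)

  _≺?_ : ∀ x y → Dec (x ≺ y)
  x ≺? y = T? (lt x y)

  AcceptingRunFrom : Config nQ nC → Set
  AcceptingRunFrom κ = Σ (Fin nQ) λ qF → Σ (Fin nC → ℕ) λ v →
    T (F qF) × (∀ c → v c ≡ 0) × Run M κ (qF , v)

  module _
    (≺-irrefl : ∀ x → ¬ x ≺ x)
    (≺-trans : ∀ x y z → x ≺ y → y ≺ z → x ≺ z)
    (≺-total : ∀ x y → x ≢ y → x ≺ y ⊎ y ≺ x)
    (⋖-cover : ∀ x y → (x ⋖ y → x ≺ y × (∀ z → ¬ (x ≺ z × z ≺ y)))
                     × (x ≺ y × (∀ z → ¬ (x ≺ z × z ≺ y)) → x ⋖ y))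
    (least greatest : Fin n) (least-min : T (minP least)) (greatest-max : T (maxP greatest))
    (min-max-bounds : ∀ x y → (T (minP x) → x ≺ y ⊎ x ≡ y) × (T (maxP x) → y ≺ x ⊎ y ≡ x))
    (states-disjoint : ∀ x q → T (st q x) → ∀ q' → q' ≢ q → ¬ T (st q' x))
    (min-max-states : ∀ x → (T (minP x) → T (st qI x))
                          × (T (maxP x) → ∃[ qF ] (T (F qF) × T (st qF x))))
    (successor-step : ∀ x y → x ⋖ y →
        (Σ (Fin nQ) λ q → Σ (Fin nC) λ c → Σ (Fin nQ) λ q' →
           T (δ q (inc c) q') × T (st q x) × T (incP c x) × T (st q' y))
      ⊎ (Σ (Fin nQ) λ q → Σ (Fin nC) λ c → Σ (Fin nQ) λ q' →
           T (δ q (dec c) q') × T (st q x) × T (decP c x) × T (st q' y)))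
    (inc-exclusive : ∀ x c → T (incP c x) → ¬ T (decP c x)
        × (∀ c' → c' ≢ c → ¬ T (decP c' x) × ¬ T (incP c' x)))
    (dec-exclusive : ∀ x c → T (decP c x) → ¬ T (incP c x)
        × (∀ c' → c' ≢ c → ¬ T (incP c' x) × ¬ T (decP c' x)))
    (max-unlabelled : ∀ x → T (maxP x) → ∀ c → ¬ T (incP c x) × ¬ T (decP c x))
    (s-labels : ∀ x y → T (s x y) → ∃[ c ] (T (incP c x) × T (decP c y)))
    (s-forward : ∀ x y → T (s x y) → x ≺ y)
    (s-partner : ∀ x → T (maxP x) ⊎ ExactlyOne (λ y → T (s x y) ⊎ T (s y x)))
    where

    state-functional : ∀ {x q q'} → T (st q x) → T (st q' x) → q ≡ q'
    state-functional {x} {q} {q'} qx q'x with q' ≟ q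
    ... | yes q'≡q = sym q'≡q
    ... | no  q'≢q = contradiction q'x (states-disjoint x q qx q' q'≢q)

    inc-functional : ∀ {x c c'} → T (incP c x) → T (incP c' x) → c ≡ c'
    inc-functional {x} {c} {c'} cx c'x with c' ≟ c
    ... | yes c'≡c = sym c'≡c
    ... | no  c'≢c = contradiction c'x (proj₂ (proj₂ (inc-exclusive x c cx) c' c'≢c))

    dec-functional : ∀ {x c c'} → T (decP c x) → T (decP c' x) → c ≡ c'
    dec-functional {x} {c} {c'} cx c'x with c' ≟ c
    ... | yes c'≡c = sym c'≡c
    ... | no  c'≢c = contradiction c'x (proj₂ (proj₂ (dec-exclusive x c cx) c' c'≢c))

    inc⇒¬dec : ∀ {x c c'} → T (incP c x) → ¬ T (decP c' x)
    inc⇒¬dec {x} {c} {c'} cx with c' ≟ c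
    ... | yes refl = proj₁ (inc-exclusive x c cx)
    ... | no  c'≢c = proj₁ (proj₂ (inc-exclusive x c cx) c' c'≢c)

    inc⇒¬max : ∀ {x c} → T (incP c x) → ¬ T (maxP x)
    inc⇒¬max {x} {c} cx max = proj₁ (max-unlabelled x max c) cx

    dec⇒¬max : ∀ {x c} → T (decP c x) → ¬ T (maxP x)
    dec⇒¬max {x} {c} cx max = proj₂ (max-unlabelled x max c) cx

    inc-partner : ∀ {x c} → T (incP c x) → ∃[ y ] T (s x y)
    inc-partner {x} cx with s-partner x
    ... | inj₁ max                = contradiction max (inc⇒¬max cx)
    ... | inj₂ (y , inj₁ sxy , _) = y , sxy
    ... | inj₂ (y , inj₂ syx , _) = contradiction (proj₂ (proj₂ (s-labels y x syx))) (inc⇒¬dec cx)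

    dec-partner : ∀ {y c} → T (decP c y) → ∃[ x ] (T (s x y) × T (incP c x))
    dec-partner {y} cy with s-partner y
    ... | inj₁ max                = contradiction max (dec⇒¬max cy)
    ... | inj₂ (x , inj₁ syx , _) = contradiction cy (inc⇒¬dec (proj₁ (proj₂ (s-labels y x syx))))
    ... | inj₂ (x , inj₂ sxy , _) with s-labels x y sxy
    ...   | c' , c'x , c'y rewrite dec-functional cy c'y = x , sxy , c'x

    s-functional : ∀ {x y y'} → T (s x y) → T (s x y') → y ≡ y'
    s-functional {x} {y} {y'} sxy sxy' with s-partner x
    ... | inj₁ max             = contradiction max (inc⇒¬max (proj₁ (proj₂ (s-labels x y sxy))))
    ... | inj₂ (_ , _ , uniq) = trans (uniq y (inj₁ sxy)) (sym (uniq y' (inj₁ sxy')))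

    s-injective : ∀ {x x' y} → T (s x y) → T (s x' y) → x ≡ x'
    s-injective {x} {x'} {y} sxy sx'y with s-partner y
    ... | inj₁ max             = contradiction max (dec⇒¬max (proj₂ (proj₂ (s-labels x y sxy))))
    ... | inj₂ (_ , _ , uniq) = trans (uniq x (inj₂ sxy)) (sym (uniq x' (inj₂ sx'y)))

    ⋖⇒≺ : ∀ {y z} → y ⋖ z → y ≺ z
    ⋖⇒≺ {y} {z} = proj₁ ∘ proj₁ (⋖-cover y z)

    ⋖-nothing-between : ∀ {y z w} → y ⋖ z → y ≺ w → ¬ w ≺ z
    ⋖-nothing-between {y} {z} {w} y⋖z y≺w w≺z =
      proj₂ (proj₁ (⋖-cover y z) y⋖z) w (y≺w , w≺z)

    ≺-⋖⇒≺ : ∀ {x y z} → y ⋖ z → x ≺ z → x ≢ y → x ≺ y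
    ≺-⋖⇒≺ {x} {y} y⋖z x≺z x≢y with ≺-total x y x≢y
    ... | inj₁ x≺y = x≺y
    ... | inj₂ y≺x = contradiction x≺z (⋖-nothing-between y⋖z y≺x)

    Pending : Fin nC → Fin n → Fin n → Set
    Pending c y x = T (incP c x) × x ≺ y × ¬ (∃[ w ] (T (s x w) × w ≺ y))

    pending? : ∀ c y → Decidable (Pending c y)
    pending? c y x = T? (incP c x) ×-dec x ≺? y ×-dec ¬? (any? λ w → T? (s x w) ×-dec w ≺? y)

    counters : Fin n → Fin nC → ℕ
    counters y c = count (pending? c y)

    ¬inc⇒pending⇔ : ∀ {c x} → ¬ T (incP c x) → ∀ y z → Pending c y x ⇔ Pending c z x
    ¬inc⇒pending⇔ ¬cx y z =
      mk⇔ (λ p → contradiction (proj₁ p) ¬cx) (λ p → contradiction (proj₁ p) ¬cx)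

    pending-⋖ : ∀ {c x y z} → y ⋖ z → x ≢ y → ¬ T (s x y) → Pending c y x ⇔ Pending c z x
    pending-⋖ {c} {x} {y} {z} y⋖z x≢y ¬sxy = mk⇔ to from
      where
      to : Pending c y x → Pending c z x
      to (cx , x≺y , ¬late) = cx , ≺-trans x y z x≺y (⋖⇒≺ y⋖z) , λ where
        (w , sxw , w≺z) → case w ≟ y of λ where
          (yes refl) → ¬sxy sxw
          (no w≢y)   → ¬late (w , sxw , ≺-⋖⇒≺ y⋖z w≺z w≢y)
      from : Pending c z x → Pending c y x
      from (cx , x≺z , ¬late) = cx , ≺-⋖⇒≺ y⋖z x≺z x≢y , λ where
        (w , sxw , w≺y) → ¬late (w , sxw , ≺-trans w y z w≺y (⋖⇒≺ y⋖z))

    counters-unchanged : ∀ {c y z} → y ⋖ z → ¬ T (incP c y) → ¬ T (decP c y) →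
                         counters z c ≡ counters y c
    counters-unchanged {c} {y} {z} y⋖z ¬cy ¬c̄y = count-cong (pending? c z) (pending? c y) same
      where
      same : ∀ {x} → Pending c z x ⇔ Pending c y x
      same {x} with x ≟ y | T? (s x y)
      ... | yes refl | _       = ¬inc⇒pending⇔ ¬cy z y
      ... | no x≢y   | no ¬sxy = ⇔-sym (pending-⋖ y⋖z x≢y ¬sxy)
      ... | no _     | yes sxy = ¬inc⇒pending⇔ ¬cx z y
        where
        ¬cx : ¬ T (incP c x)
        ¬cx cx with s-labels x y sxy
        ... | c' , c'x , c'y rewrite inc-functional cx c'x = ¬c̄y c'y

    counters-inc : ∀ {c y z} → y ⋖ z → T (incP c y) → counters z c ≡ suc (counters y c)
    counters-inc {c} {y} {z} y⋖z cy =
      count-insert (pending? c y) (pending? c z) (≺-irrefl y ∘ proj₁ ∘ proj₂) pending-at-z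
        (λ x≢y → pending-⋖ y⋖z x≢y (λ sxy → inc⇒¬dec cy (proj₂ (proj₂ (s-labels _ y sxy)))))
      where
      pending-at-z : Pending c z y
      pending-at-z = cy , ⋖⇒≺ y⋖z , λ where
        (w , syw , w≺z) → ⋖-nothing-between y⋖z (s-forward y w syw) w≺z

    counters-dec : ∀ {c y z} → y ⋖ z → T (decP c y) → counters y c ≡ suc (counters z c)
    counters-dec {c} {y} {z} y⋖z cy with dec-partner cy
    ... | x₀ , sx₀y , cx₀ =
      count-insert (pending? c z) (pending? c y) closed-at-z pending-at-y same
      where
      closed-at-z : ¬ Pending c z x₀
      closed-at-z (_ , _ , ¬late) = ¬late (y , sx₀y , ⋖⇒≺ y⋖z)
      pending-at-y : Pending c y x₀
      pending-at-y = cx₀ , s-forward x₀ y sx₀y , λ where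
        (w , sx₀w , w≺y) → ≺-irrefl y (subst (_≺ y) (sym (s-functional sx₀y sx₀w)) w≺y)
      same : ∀ {x} → x ≢ x₀ → Pending c z x ⇔ Pending c y x
      same {x} x≢x₀ with x ≟ y
      ... | yes refl = ¬inc⇒pending⇔ (λ cx → inc⇒¬dec cx cy) z y
      ... | no x≢y   = ⇔-sym (pending-⋖ y⋖z x≢y (λ sxy → x≢x₀ (s-injective sxy sx₀y)))

    counters-min : ∀ {x} → T (minP x) → ∀ c → counters x c ≡ 0
    counters-min {x} min c = count-empty (pending? c x) λ where
      a (_ , a≺x , _) → case proj₁ (min-max-bounds x a) min of λ where
        (inj₁ x≺a)  → ≺-irrefl a (≺-trans a x a a≺x x≺a)
        (inj₂ refl) → ≺-irrefl a a≺x

    counters-max : ∀ {y} → T (maxP y) → ∀ c → counters y c ≡ 0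
    counters-max {y} max c = count-empty (pending? c y) λ where
      a (ca , _ , ¬late) → case inc-partner ca of λ where
        (b , sab) → case proj₂ (min-max-bounds y b) max of λ where
          (inj₁ b≺y)  → ¬late (b , sab , b≺y)
          (inj₂ refl) → dec⇒¬max (proj₂ (proj₂ (s-labels a b sab))) max

    open FiniteStrictOrder _≺?_ ≺-irrefl (λ {x} {y} {z} → ≺-trans x y z)
      using (≻-wellFounded; cover-exists)

    successor-exists : ∀ {y} → ¬ T (maxP y) → ∃[ z ] y ⋖ z
    successor-exists {y} ¬max with proj₂ (min-max-bounds greatest y) greatest-max
    ... | inj₂ refl = contradiction greatest-max ¬max
    ... | inj₁ y≺greatest with cover-exists y≺greatest
    ...   | z , y≺z , nothing-between = z , proj₂ (⋖-cover y z) (y≺z , nothing-between)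

    incV-⋖ : ∀ {c y z v} → y ⋖ z → T (incP c y) → v ≗ counters y → incV c v ≗ counters z
    incV-⋖ {c} {y} {z} {v} y⋖z cy v≗ d with d ≟ c
    ... | yes refl = trans (cong suc (v≗ d)) (sym (counters-inc y⋖z cy))
    ... | no d≢c   = trans (v≗ d) (sym (counters-unchanged y⋖z
                                          (λ dy → d≢c (inc-functional dy cy)) (inc⇒¬dec cy)))

    decV-⋖ : ∀ {c y z v} → y ⋖ z → T (decP c y) → v ≗ counters y → decV c v ≗ counters z
    decV-⋖ {c} {y} {z} {v} y⋖z cy v≗ d with d ≟ c
    ... | yes refl = cong (_∸ 1) (trans (v≗ d) (counters-dec y⋖z cy))
    ... | no d≢c   = trans (v≗ d) (sym (counters-unchanged y⋖z
                                          (λ dy → inc⇒¬dec dy cy) (λ dy → d≢c (dec-functional dy cy))))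

    step-⋖ : ∀ {y z q v} → y ⋖ z → T (st q y) → v ≗ counters y →
             ∃[ q' ] ∃[ v' ] (T (st q' z) × v' ≗ counters z × Step M (q , v) (q' , v'))
    step-⋖ {y} {z} {q} {v} y⋖z qy v≗ with successor-step y z y⋖z
    ... | inj₁ (q₀ , c , q' , inc∈δ , q₀y , cy , q'z) rewrite state-functional qy q₀y =
      q' , incV c v , q'z , incV-⋖ y⋖z cy v≗ , stepInc inc∈δ
    ... | inj₂ (q₀ , c , q' , dec∈δ , q₀y , cy , q'z) rewrite state-functional qy q₀y =
      q' , decV c v , q'z , decV-⋖ y⋖z cy v≗ , stepDec dec∈δ v-positive
      where
      v-positive : 0 < v c
      v-positive = subst (0 <_) (sym (trans (v≗ c) (counters-dec y⋖z cy))) z<s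

    prepend : ∀ {κ κ'} → Step M κ κ' → AcceptingRunFrom κ' → AcceptingRunFrom κ
    prepend step₁ (qF , v , final , v≡0 , run) = qF , v , final , v≡0 , step step₁ run

    run-from : ∀ y → Acc (flip _≺_) y → ∀ {q v} → T (st q y) → v ≗ counters y →
               AcceptingRunFrom (q , v)
    run-from y (acc rs) {q} {v} qy v≗ with T? (maxP y)
    ... | yes max with proj₂ (min-max-states y) max
    ...   | qF , final , qFy rewrite state-functional qy qFy =
      qF , v , final , (λ c → trans (v≗ c) (counters-max max c)) , done
    run-from y (acc rs) qy v≗ | no ¬max with successor-exists ¬max
    ... | z , y⋖z with step-⋖ y⋖z qy v≗
    ...   | q' , v' , q'z , v'≗ , step₁ = prepend step₁ (run-from z (rs (⋖⇒≺ y⋖z)) q'z v'≗)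

    acceptingRun : HasAcceptingRun M
    acceptingRun = run-from least (≻-wellFounded least) (proj₁ (min-max-states least) least-min)
                            (λ c → sym (counters-min least-min c))

modelToRun : ∀ {nQ nC} (M : MCA nQ nC) → HasFiniteModel M → HasAcceptingRun M
modelToRun M (𝔄 , (irrefl , trans′ , total , ⋖-cover)
             , ((least , least-min , _) , (greatest , greatest-max , _))
             , bounds , states , ends , moves , _ , inc-excl , dec-excl , max-idle , s-lab , s-fwd , s-part) =
  ModelToRun.acceptingRun M 𝔄 irrefl trans′ total ⋖-cover least greatest least-min greatest-max
    bounds (λ x → proj₂ (states x)) ends moves inc-excl dec-excl max-idle s-lab s-fwd s-part

module _ {nC : ℕ} where

  inc-injective : ∀ {c c' : Fin nC} → inc c ≡ inc c' → c ≡ c'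
  inc-injective refl = refl

  dec-injective : ∀ {c c' : Fin nC} → dec c ≡ dec c' → c ≡ c'
  dec-injective refl = refl

  inc-label-unique : ∀ {o : Maybe (Op nC)} {c c'} → o ≡ just (inc c) → o ≡ just (inc c') → c ≡ c'
  inc-label-unique isInc isInc' = inc-injective (just-injective (trans (sym isInc) isInc'))

  dec-label-unique : ∀ {o : Maybe (Op nC)} {c c'} → o ≡ just (dec c) → o ≡ just (dec c') → c ≡ c'
  dec-label-unique isDec isDec' = dec-injective (just-injective (trans (sym isDec) isDec'))

  inc-label⇒¬dec-label : ∀ {o : Maybe (Op nC)} {c c'} → o ≡ just (inc c) → o ≢ just (dec c')
  inc-label⇒¬dec-label isInc isDec = case trans (sym isInc) isDec of λ ()

  _≟ₒ_ : DecidableEquality (Op nC)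
  inc c ≟ₒ inc c' = map′ (cong inc) inc-injective (c ≟ c')
  dec c ≟ₒ dec c' = map′ (cong dec) dec-injective (c ≟ c')
  inc _ ≟ₒ dec _  = no λ ()
  dec _ ≟ₒ inc _  = no λ ()

module RunTrace {nQ nC : ℕ} (M : MCA nQ nC) where
  open MCA M

  data StepBy : Maybe (Op nC) → Config nQ nC → Config nQ nC → Set where
    idle  : ∀ {κ} → StepBy nothing κ κ
    byInc : ∀ {p q c v} → T (δ p (inc c) q) → StepBy (just (inc c)) (p , v) (q , incV c v)
    byDec : ∀ {p q c v} → T (δ p (dec c) q) → 0 < v c → StepBy (just (dec c)) (p , v) (q , decV c v)

  StepBy-δ : ∀ {o κ κ'} → StepBy (just o) κ κ' → T (δ (proj₁ κ) o (proj₁ κ'))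
  StepBy-δ (byInc inc∈δ)   = inc∈δ
  StepBy-δ (byDec dec∈δ _) = dec∈δ

  StepBy-positive : ∀ {c κ κ'} → StepBy (just (dec c)) κ κ' → 0 < proj₂ κ c
  StepBy-positive (byDec _ positive) = positive

  StepBy-inc : ∀ {c o κ κ'} → StepBy o κ κ' → o ≡ just (inc c) → proj₂ κ' c ≡ suc (proj₂ κ c)
  StepBy-inc {c} (byInc _) refl with c ≟ c
  ... | yes _   = refl
  ... | no c≢c = contradiction refl c≢c

  StepBy-dec : ∀ {c o κ κ'} → StepBy o κ κ' → o ≡ just (dec c) → suc (proj₂ κ' c) ≡ proj₂ κ c
  StepBy-dec {c} (byDec _ positive) refl with c ≟ c
  ... | yes _   = m+[n∸m]≡n positive
  ... | no c≢c = contradiction refl c≢c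

  StepBy-other : ∀ {c o κ κ'} → StepBy o κ κ' → o ≢ just (inc c) → o ≢ just (dec c) →
                 proj₂ κ' c ≡ proj₂ κ c
  StepBy-other idle _ _ = refl
  StepBy-other {c} (byInc {c = c'} _) ≢inc _ with c ≟ c'
  ... | yes refl = contradiction refl ≢inc
  ... | no _     = refl
  StepBy-other {c} (byDec {c = c'} _ _) _ ≢dec with c ≟ c'
  ... | yes refl = contradiction refl ≢dec
  ... | no _     = refl

  opOf : ∀ {κ κ'} → Step M κ κ' → Op nC
  opOf (stepInc {c = c} _)   = inc c
  opOf (stepDec {c = c} _ _) = dec c

  stepBy : ∀ {κ κ'} (st : Step M κ κ') → StepBy (just (opOf st)) κ κ'
  stepBy (stepInc inc∈δ)          = byInc inc∈δ
  stepBy (stepDec dec∈δ positive) = byDec dec∈δ positive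

  length : ∀ {κ₀ κ₁} → Run M κ₀ κ₁ → ℕ
  length done       = 0
  length (step _ r) = suc (length r)

  -- Past the end of the run the configuration stays put and there is no operation.
  configAt : ∀ {κ₀ κ₁} → Run M κ₀ κ₁ → ℕ → Config nQ nC
  configAt {κ₀} _    zero    = κ₀
  configAt {κ₀} done (suc _) = κ₀
  configAt (step _ r) (suc i) = configAt r i

  opAt : ∀ {κ₀ κ₁} → Run M κ₀ κ₁ → ℕ → Maybe (Op nC)
  opAt done        _       = nothing
  opAt (step st _) zero    = just (opOf st)
  opAt (step _ r)  (suc i) = opAt r i

  stepBy-at : ∀ {κ₀ κ₁} (r : Run M κ₀ κ₁) i → StepBy (opAt r i) (configAt r i) (configAt r (suc i))
  stepBy-at done        zero    = idle
  stepBy-at done        (suc _) = idle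
  stepBy-at (step st _) zero    = stepBy st
  stepBy-at (step _ r)  (suc i) = stepBy-at r i

  configAt-length : ∀ {κ₀ κ₁} (r : Run M κ₀ κ₁) → configAt r (length r) ≡ κ₁
  configAt-length done       = refl
  configAt-length (step _ r) = configAt-length r

  opAt-beyond : ∀ {κ₀ κ₁} (r : Run M κ₀ κ₁) {i} → length r ≤ i → opAt r i ≡ nothing
  opAt-beyond done       _         = refl
  opAt-beyond (step _ r) (s≤s len≤i) = opAt-beyond r len≤i

  opAt-within : ∀ {κ₀ κ₁} (r : Run M κ₀ κ₁) {i} → i < length r → ∃[ o ] opAt r i ≡ just o
  opAt-within (step st _) {zero}  _           = opOf st , refl
  opAt-within (step _ r)  {suc i} (s≤s i<len) = opAt-within r i<len

  stepBy-at-op : ∀ {κ₀ κ₁} (r : Run M κ₀ κ₁) {i o} → opAt r i ≡ just o →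
                 StepBy (just o) (configAt r i) (configAt r (suc i))
  stepBy-at-op r {i} isO = subst (λ o → StepBy o (configAt r i) (configAt r (suc i))) isO (stepBy-at r i)

  module Counter {κ₀ κ₁} (r : Run M κ₀ κ₁) (c : Fin nC) where

    IncAt DecAt : ℕ → Set
    IncAt i = opAt r i ≡ just (inc c)
    DecAt i = opAt r i ≡ just (dec c)

    incAt? : Decidable IncAt
    incAt? i = ≡-dec _≟ₒ_ (opAt r i) (just (inc c))

    decAt? : Decidable DecAt
    decAt? i = ≡-dec _≟ₒ_ (opAt r i) (just (dec c))

    incs decs : ℕ → ℕ
    incs = countBelow incAt?
    decs = countBelow decAt?

    valueAt : ℕ → ℕ
    valueAt i = proj₂ (configAt r i) c

    positive-at-dec : ∀ {j} → DecAt j → 0 < valueAt j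
    positive-at-dec isDec = StepBy-positive (stepBy-at-op r isDec)

    balance : ∀ j → valueAt j + decs j ≡ proj₂ κ₀ c + incs j
    balance zero = refl
    balance (suc j) = case incAt? j ,′ decAt? j of λ where
      (yes isInc , _) → begin
        valueAt (suc j) + decs (suc j) ≡⟨ cong₂ _+_ (StepBy-inc (stepBy-at r j) isInc)
                                                     (countBelow-no decAt? (inc-label⇒¬dec-label isInc)) ⟩
        suc (valueAt j + decs j)        ≡⟨ cong suc (balance j) ⟩
        suc (proj₂ κ₀ c + incs j)       ≡⟨ +-suc (proj₂ κ₀ c) (incs j) ⟨
        proj₂ κ₀ c + suc (incs j)       ≡⟨ cong (proj₂ κ₀ c +_) (countBelow-yes incAt? isInc) ⟨
        proj₂ κ₀ c + incs (suc j)       ∎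
      (no notInc , yes isDec) → begin
        valueAt (suc j) + decs (suc j)   ≡⟨ cong (valueAt (suc j) +_) (countBelow-yes decAt? isDec) ⟩
        valueAt (suc j) + suc (decs j)   ≡⟨ +-suc (valueAt (suc j)) (decs j) ⟩
        suc (valueAt (suc j)) + decs j   ≡⟨ cong (_+ decs j) (StepBy-dec (stepBy-at r j) isDec) ⟩
        valueAt j + decs j               ≡⟨ balance j ⟩
        proj₂ κ₀ c + incs j              ≡⟨ cong (proj₂ κ₀ c +_) (countBelow-no incAt? notInc) ⟨
        proj₂ κ₀ c + incs (suc j)        ∎
      (no notInc , no notDec) → begin
        valueAt (suc j) + decs (suc j) ≡⟨ cong₂ _+_ (StepBy-other (stepBy-at r j) notInc notDec)
                                                     (countBelow-no decAt? notDec) ⟩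
        valueAt j + decs j             ≡⟨ balance j ⟩
        proj₂ κ₀ c + incs j            ≡⟨ cong (proj₂ κ₀ c +_) (countBelow-no incAt? notInc) ⟨
        proj₂ κ₀ c + incs (suc j)      ∎

module RunToModel {nQ nC : ℕ} (M : MCA nQ nC) {qF : Fin nQ} {w : Fin nC → ℕ}
                  (final : T (MCA.F M qF)) (w≡0 : ∀ c → w c ≡ 0)
                  (r : Run M (MCA.qI M , λ _ → 0) (qF , w)) where
  open MCA M
  open RunTrace M
  open Counter r
  module Fifo (c : Fin nC) = FifoMatching (incAt? c) (decAt? c)
  open Fifo using (Matched; matched?)

  k : ℕ
  k = length r

  stateAt : ℕ → Fin nQ
  stateAt i = proj₁ (configAt r i)

  fewer-decs : ∀ {c j} → DecAt c j → decs c j < incs c j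
  fewer-decs {c} {j} isDec = subst (decs c j <_) (balance c j) (m<n+m (decs c j) (positive-at-dec c isDec))

  balanced-at-end : ∀ c → incs c k ≤ decs c k
  balanced-at-end c = ≤-reflexive (begin
    incs c k              ≡⟨ balance c k ⟨
    valueAt c k + decs c k ≡⟨ cong (λ κ → proj₂ κ c + decs c k) (configAt-length r) ⟩
    w c + decs c k         ≡⟨ cong (_+ decs c k) (w≡0 c) ⟩
    decs c k               ∎)

  𝔄 : Structure nQ nC
  𝔄 = record
    { n    = suc k
    ; st   = λ q x → ⌊ stateAt (toℕ x) ≟ q ⌋
    ; incP = λ c x → ⌊ incAt? c (toℕ x) ⌋
    ; decP = λ c x → ⌊ decAt? c (toℕ x) ⌋
    ; minP = λ x → ⌊ x ≟ zero ⌋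
    ; maxP = λ x → ⌊ toℕ x ℕ.≟ k ⌋
    ; lt   = λ x y → ⌊ toℕ x <? toℕ y ⌋
    ; sc   = λ x y → ⌊ suc (toℕ x) ℕ.≟ toℕ y ⌋
    ; s    = λ x y → ⌊ any? (λ c → matched? c (toℕ x) (toℕ y)) ⌋
    }

  open Structure 𝔄

  ordered : OrderedStructure 𝔄
  ordered = (λ x x<x → <-irrefl refl (toWitness x<x))
          , (λ x y z x<y y<z → fromWitness (<-trans (toWitness x<y) (toWitness y<z)))
          , total
          , λ x y → successor⇒cover x y , cover⇒successor x y
    where
    total : ∀ x y → x ≢ y → T (lt x y) ⊎ T (lt y x)
    total x y x≢y with <-cmp (toℕ x) (toℕ y)
    ... | tri< x<y _ _ = inj₁ (fromWitness x<y)
    ... | tri≈ _ x≡y _ = contradiction (toℕ-injective x≡y) x≢y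
    ... | tri> _ _ y<x = inj₂ (fromWitness y<x)
    successor⇒cover : ∀ x y → T (sc x y) → T (lt x y) × (∀ z → ¬ (T (lt x z) × T (lt z y)))
    successor⇒cover x y x⋖y with Equivalence.to suc-toℕ⇔covers (toWitness x⋖y)
    ... | x<y , nothing-between =
      fromWitness x<y , λ z (x<z , z<y) → nothing-between z (toWitness x<z , toWitness z<y)
    cover⇒successor : ∀ x y → T (lt x y) × (∀ z → ¬ (T (lt x z) × T (lt z y))) → T (sc x y)
    cover⇒successor x y (x<y , nothing-between) = fromWitness (Equivalence.from suc-toℕ⇔covers
      (toWitness x<y , λ z (x<z , z<y) → nothing-between z (fromWitness x<z , fromWitness z<y)))

  within : ∀ {x} → ¬ T (maxP x) → toℕ x < k
  within {x} ¬max with m<1+n⇒m<n∨m≡n (toℕ<n x)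
  ... | inj₁ x<k = x<k
  ... | inj₂ x≡k = contradiction (fromWitness x≡k) ¬max

  min-max-unique : ExactlyOne (λ x → T (minP x)) × ExactlyOne (λ x → T (maxP x))
  min-max-unique = (zero , tt , λ _ min → toWitness min)
                 , (fromℕ k , fromWitness (toℕ-fromℕ k) ,
                    λ _ max → toℕ-injective (trans (toWitness max) (sym (toℕ-fromℕ k))))

  min-max-extremal : ∀ x y → (T (minP x) → T (lt x y) ⊎ x ≡ y) × (T (maxP x) → T (lt y x) ⊎ y ≡ x)
  min-max-extremal x y = min-extremal , max-extremal
    where
    min-extremal : T (minP x) → T (lt x y) ⊎ x ≡ y
    min-extremal min = subst (λ x → T (lt x y) ⊎ x ≡ y) (sym (toWitness min)) (zero-least y)
      where
      zero-least : ∀ y → T (lt zero y) ⊎ zero ≡ y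
      zero-least zero    = inj₂ refl
      zero-least (suc _) = inj₁ tt
    max-extremal : T (maxP x) → T (lt y x) ⊎ y ≡ x
    max-extremal max with toWitness max | m<1+n⇒m<n∨m≡n (toℕ<n y)
    ... | x≡k | inj₁ y<k = inj₁ (fromWitness (subst (toℕ y <_) (sym x≡k) y<k))
    ... | x≡k | inj₂ y≡k = inj₂ (toℕ-injective (trans y≡k (sym x≡k)))

  states-partition : ∀ x → (∃[ q ] T (st q x)) × (∀ q → T (st q x) → ∀ q' → q' ≢ q → ¬ T (st q' x))
  states-partition x = (stateAt (toℕ x) , fromWitness refl)
                     , λ q qx q' q'≢q q'x → q'≢q (trans (sym (toWitness q'x)) (toWitness qx))

  min-max-states : ∀ x → (T (minP x) → T (st qI x)) × (T (maxP x) → ∃[ q ] (T (F q) × T (st q x)))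
  min-max-states x = min-initial , λ max → qF , final , fromWitness (begin
      stateAt (toℕ x) ≡⟨ cong stateAt (toWitness max) ⟩
      stateAt k       ≡⟨ cong proj₁ (configAt-length r) ⟩
      qF              ∎)
    where
    min-initial : T (minP x) → T (st qI x)
    min-initial min with toWitness min
    ... | refl = fromWitness refl

  successor-step : ∀ x y → T (sc x y) →
      (Σ (Fin nQ) λ q → Σ (Fin nC) λ c → Σ (Fin nQ) λ q' →
         T (δ q (inc c) q') × T (st q x) × T (incP c x) × T (st q' y))
    ⊎ (Σ (Fin nQ) λ q → Σ (Fin nC) λ c → Σ (Fin nQ) λ q' →
         T (δ q (dec c) q') × T (st q x) × T (decP c x) × T (st q' y))
  successor-step x y x⋖y = case opAt-within r x<k of λ where
      (inc c , isInc) → inj₁ (stateAt (toℕ x) , c , stateAt (suc (toℕ x)) ,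
                              StepBy-δ (stepBy-at-op r isInc) , fromWitness refl ,
                              fromWitness isInc , next-state)
      (dec c , isDec) → inj₂ (stateAt (toℕ x) , c , stateAt (suc (toℕ x)) ,
                              StepBy-δ (stepBy-at-op r isDec) , fromWitness refl ,
                              fromWitness isDec , next-state)
    where
    1+x≡y : suc (toℕ x) ≡ toℕ y
    1+x≡y = toWitness x⋖y
    x<k : toℕ x < k
    x<k = subst (_≤ k) (sym 1+x≡y) (m<1+n⇒m≤n (toℕ<n y))
    next-state : T (st (stateAt (suc (toℕ x))) y)
    next-state = fromWitness (cong stateAt (sym 1+x≡y))

  non-max-labelled : ∀ x → ¬ T (maxP x) → ∃[ c ] (T (incP c x) ⊎ T (decP c x))
  non-max-labelled x ¬max = case opAt-within r (within ¬max) of λ where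
    (inc c , isInc) → c , inj₁ (fromWitness isInc)
    (dec c , isDec) → c , inj₂ (fromWitness isDec)

  inc-exclusive : ∀ x c → T (incP c x) → ¬ T (decP c x)
      × (∀ c' → c' ≢ c → ¬ T (decP c' x) × ¬ T (incP c' x))
  inc-exclusive x c cx =
      (λ c̄x → inc-label⇒¬dec-label (toWitness cx) (toWitness c̄x))
    , λ c' c'≢c → (λ c̄'x → inc-label⇒¬dec-label (toWitness cx) (toWitness c̄'x))
                , (λ c'x → c'≢c (inc-label-unique (toWitness c'x) (toWitness cx)))

  dec-exclusive : ∀ x c → T (decP c x) → ¬ T (incP c x)
      × (∀ c' → c' ≢ c → ¬ T (incP c' x) × ¬ T (decP c' x))
  dec-exclusive x c c̄x =
      (λ cx → inc-label⇒¬dec-label (toWitness cx) (toWitness c̄x))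
    , λ c' c'≢c → (λ c'x → inc-label⇒¬dec-label (toWitness c'x) (toWitness c̄x))
                , (λ c̄'x → c'≢c (dec-label-unique (toWitness c̄'x) (toWitness c̄x)))

  max-unlabelled : ∀ x → T (maxP x) → ∀ c → ¬ T (incP c x) × ¬ T (decP c x)
  max-unlabelled x max c = (λ cx → case trans (sym (toWitness cx)) no-op of λ ())
                         , (λ c̄x → case trans (sym (toWitness c̄x)) no-op of λ ())
    where
    no-op : opAt r (toℕ x) ≡ nothing
    no-op = opAt-beyond r (≤-reflexive (sym (toWitness max)))

  s-labels : ∀ x y → T (s x y) → ∃[ c ] (T (incP c x) × T (decP c y))
  s-labels x y sxy with toWitness sxy
  ... | c , isInc , isDec , _ = c , fromWitness isInc , fromWitness isDec

  s-forward : ∀ x y → T (s x y) → T (lt x y)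
  s-forward x y sxy with toWitness sxy
  ... | c , matched@(_ , isDec , _) = fromWitness (Fifo.matched-< c (fewer-decs isDec) matched)

  module _ {x : Fin (suc k)} where

    Partner : Fin (suc k) → Set
    Partner y = T (s x y) ⊎ T (s y x)

    partner-of-inc : ∀ {c} → IncAt c (toℕ x) → toℕ x < k → ExactlyOne Partner
    partner-of-inc {c} isInc x<k with Fifo.matched-to c isInc x<k (balanced-at-end c)
    ... | j , j<k , matched =
      y , inj₁ (fromWitness (c , subst (Matched c (toℕ x)) (sym toℕ-y) matched)) , unique
      where
      y : Fin (suc k)
      y = fromℕ< (m<n⇒m<1+n j<k)
      toℕ-y : toℕ y ≡ j
      toℕ-y = toℕ-fromℕ< (m<n⇒m<1+n j<k)
      unique : ∀ y' → Partner y' → y' ≡ y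
      unique y' (inj₁ sxy') with toWitness sxy'
      ... | c' , matched' with inc-label-unique (proj₁ matched') isInc
      ...   | refl = toℕ-injective (trans (Fifo.matched-functional c matched' matched) (sym toℕ-y))
      unique y' (inj₂ sy'x) with toWitness sy'x
      ... | _ , _ , isDec' , _ = contradiction isDec' (inc-label⇒¬dec-label isInc)

    partner-of-dec : ∀ {c} → DecAt c (toℕ x) → ExactlyOne Partner
    partner-of-dec {c} isDec with Fifo.matched-from c (fewer-decs isDec) isDec
    ... | i , matched =
      y , inj₂ (fromWitness (c , subst (λ i → Matched c i (toℕ x)) (sym toℕ-y) matched)) , unique
      where
      i<x : i < toℕ x
      i<x = Fifo.matched-< c (fewer-decs isDec) matched
      y : Fin (suc k)
      y = fromℕ< (<-trans i<x (toℕ<n x))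
      toℕ-y : toℕ y ≡ i
      toℕ-y = toℕ-fromℕ< (<-trans i<x (toℕ<n x))
      unique : ∀ y' → Partner y' → y' ≡ y
      unique y' (inj₁ sxy') with toWitness sxy'
      ... | _ , isInc' , _ = contradiction isDec (inc-label⇒¬dec-label isInc')
      unique y' (inj₂ sy'x) with toWitness sy'x
      ... | c' , matched' with dec-label-unique (proj₁ (proj₂ matched')) isDec
      ...   | refl = toℕ-injective (trans (Fifo.matched-injective c matched' matched) (sym toℕ-y))

  s-partner : ∀ x → T (maxP x) ⊎ ExactlyOne (λ y → T (s x y) ⊎ T (s y x))
  s-partner x with toℕ x ℕ.≟ k
  ... | yes _   = inj₁ tt
  ... | no  x≢k = inj₂ (case opAt-within r x<k of λ where
      (inc c , isInc) → partner-of-inc isInc x<k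
      (dec c , isDec) → partner-of-dec isDec)
    where
    x<k : toℕ x < k
    x<k = within (x≢k ∘ toWitness)

  model : HasFiniteModel M
  model = 𝔄 , ordered
        , min-max-unique , min-max-extremal , states-partition , min-max-states , successor-step
        , non-max-labelled , inc-exclusive , dec-exclusive , max-unlabelled , s-labels , s-forward , s-partner

runToModel : ∀ {nQ nC} (M : MCA nQ nC) → HasAcceptingRun M → HasFiniteModel M
runToModel M (_ , _ , final , w≡0 , run) = RunToModel.model M final w≡0 run

lemma5p2 : (nQ nC : ℕ) (M : MCA nQ nC) →
    (HasFiniteModel M → HasAcceptingRun M) × (HasAcceptingRun M → HasFiniteModel M)
lemma5p2 nQ nC M = modelToRun M , runToModel M
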